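{- Let $\mathscr{A}$ be a closed set of impartial games with misère quotient $(\mathcal{Q},\mathcal{P})$ and quotient map $\Phi$. Let $G\in\mathscr{A}$ and put $x=\Phi(G)$. Then $\Phi''G\subseteq\mathcal{M}_x$.
   Context: All games are impartial; $G+H$ is the disjunctive sum. In misère play the last player to move loses; $o^-(G)$ is the misère outcome. A set $\mathscr{A}$ is closed if closed under sums and under taking options. For closed $\mathscr{A}$, $G\equiv_{\mathscr{A}}H$ iff $o^-(G+X)=o^-(H+X)$ for all $X\in\mathscr{A}$; $\mathcal{Q}=\mathscr{A}/\equiv_{\mathscr{A}}$ with quotient map $\Phi$, $\mathcal{P}$ the set of classes of misère $\mathscr{P}$-positions. $\Phi''G=\{\Phi(G'):G'\text{ an option of }G\}$. The meximal set of $x\in\mathcal{Q}$ is $\mathcal{M}_x=\{y\in\mathcal{Q}:\text{there is no }w\in\mathcal{Q}\text{ with both }xw\in\mathcal{P}\text{ and }yw\in\mathcal{P}\}$. -}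

module Defs where

open import Data.Nat using (ℕ; zero; suc; _+_)
open import Data.Fin using (Fin; splitAt)
open import Data.Fin.Properties using (any?)
open import Data.Sum using (_⊎_; inj₁; inj₂; [_,_]′)
open import Data.Product using (Σ; ∃; _×_; _,_; proj₁)
open import Relation.Nullary using (¬_; Dec; yes; no)
open import Relation.Binary.PropositionalEquality using (_≡_; refl)

data Game : Set where
  mk : (n : ℕ) → (Fin n → Game) → Game

#opts : Game → ℕ
#opts (mk n _) = n

opt : (G : Game) → Fin (#opts G) → Game
opt (mk _ f) i = f i

Option : Game → Game → Set
Option G' G = ∃ λ (i : Fin (#opts G)) → G' ≡ opt G i

-- Disjunctive sum: move in exactly one component.
infixl 6 _⊕_
_⊕_ : Game → Game → Game
mk n f ⊕ mk m g =
  mk (n + m) (λ i → [ (λ j → f j ⊕ mk m g) , (λ k → mk n f ⊕ g k) ]′ (splitAt n i))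

data Outcome : Set where
  𝒫 𝒩 : Outcome

-- Misère outcome (last player to move loses): a terminal position is an
-- 𝒩-position (the player to move wins); otherwise 𝒩 iff some option is 𝒫.
_≟ₒ_ : (a b : Outcome) → Dec (a ≡ b)
𝒫 ≟ₒ 𝒫 = yes refl
𝒫 ≟ₒ 𝒩 = no λ ()
𝒩 ≟ₒ 𝒫 = no λ ()
𝒩 ≟ₒ 𝒩 = yes refl

o⁻ : Game → Outcome
o⁻ (mk zero f) = 𝒩
o⁻ (mk (suc n) f) with any? (λ i → o⁻ (f i) ≟ₒ 𝒫)
... | yes _ = 𝒩
... | no _ = 𝒫

record ClosedSet : Set₁ where
  field
    Mem        : Game → Set
    sum-closed : ∀ {G H} → Mem G → Mem H → Mem (G ⊕ H)
    opt-closed : ∀ {G} → Mem G → (i : Fin (#opts G)) → Mem (opt G i)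

module Quotient (𝒜 : ClosedSet) where
  open ClosedSet 𝒜

  _≡𝒜_ : Game → Game → Set
  G ≡𝒜 H = ∀ X → Mem X → o⁻ (G ⊕ X) ≡ o⁻ (H ⊕ X)

  -- The misère quotient 𝒬 = 𝒜 / ≡𝒜, presented as a setoid: elements are
  -- games of 𝒜, with equality ≈ given by ≡𝒜.
  𝒬 : Set
  𝒬 = Σ Game Mem

  _≈_ : 𝒬 → 𝒬 → Set
  (G , _) ≈ (H , _) = G ≡𝒜 H

  Φ : (G : Game) → Mem G → 𝒬
  Φ G a = G , a

  _·_ : 𝒬 → 𝒬 → 𝒬
  (G , a) · (H , b) = G ⊕ H , sum-closed a b

  In𝒫 : 𝒬 → Set
  In𝒫 (G , _) = o⁻ G ≡ 𝒫

  Φ'' : (G : Game) → Mem G → 𝒬 → Set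
  Φ'' G a y = ∃ λ (i : Fin (#opts G)) → y ≈ Φ (opt G i) (opt-closed a i)

  𝓜 : 𝒬 → 𝒬 → Set
  𝓜 x y = ¬ (Σ 𝒬 λ w → In𝒫 (x · w) × In𝒫 (y · w))

{-# OPTIONS --safe #-}
module Submission where

-- If Φ(G') and Φ(G) had a common 𝒫-partner w = Φ(W), then G' + W would be a
-- 𝒫-position and an option of the 𝒫-position G + W, which is impossible:
-- a position with a 𝒫-option is an 𝒩-position.

open import Defs
open import Data.Nat using (zero; suc)
open import Data.Fin using (Fin; _↑ˡ_)
open import Data.Fin.Properties using (any?; splitAt-↑ˡ)
open import Data.Product using (_,_)
open import Data.Sum using (_⊎_; [_,_]′)
open import Relation.Nullary using (yes; no; contradiction)
open import Relation.Binary.PropositionalEquality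
  using (_≡_; _≢_; refl; sym; trans; cong)

𝒩≢𝒫 : 𝒩 ≢ 𝒫
𝒩≢𝒫 ()

o⁻-𝒫-option⇒𝒩 : ∀ {G G'} → Option G' G → o⁻ G' ≡ 𝒫 → o⁻ G ≡ 𝒩
o⁻-𝒫-option⇒𝒩 {mk zero f}    (() , _)
o⁻-𝒫-option⇒𝒩 {mk (suc n) f} (i , refl) G'∈𝒫 with any? (λ j → o⁻ (f j) ≟ₒ 𝒫)
... | yes _          = refl
... | no no-𝒫-option = contradiction (i , G'∈𝒫) no-𝒫-option

⊕-optionˡ : ∀ G H (i : Fin (#opts G)) → Option (opt G i ⊕ H) (G ⊕ H)
⊕-optionˡ (mk n f) (mk m g) i = i ↑ˡ m , sym (cong pick (splitAt-↑ˡ n i m))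
  where
  pick : Fin n ⊎ Fin m → Game
  pick = [ (λ j → f j ⊕ mk m g) , (λ k → mk n f ⊕ g k) ]′

module _ (𝒜 : ClosedSet) where
  open Quotient 𝒜

  In𝒫-·-resp-≈ : ∀ {y z} w → y ≈ z → In𝒫 (y · w) → In𝒫 (z · w)
  In𝒫-·-resp-≈ {y , _} {z , _} (W , c) y≈z yw∈𝒫 = trans (sym (y≈z W c)) yw∈𝒫

lemma5p3 : (𝒜 : ClosedSet) → (G : Game) → (a : ClosedSet.Mem 𝒜 G) →
           let open Quotient 𝒜 in
           ∀ y → Φ'' G a y → 𝓜 (Φ G a) y
lemma5p3 𝒜 G a y (i , y≈G') (w@(W , _) , GW∈𝒫 , yw∈𝒫) =
  𝒩≢𝒫 (trans (sym GW∈𝒩) GW∈𝒫)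
  where
  open Quotient 𝒜

  G'W∈𝒫 : o⁻ (opt G i ⊕ W) ≡ 𝒫
  G'W∈𝒫 = In𝒫-·-resp-≈ 𝒜 {y} {Φ (opt G i) (ClosedSet.opt-closed 𝒜 a i)} w y≈G' yw∈𝒫

  GW∈𝒩 : o⁻ (G ⊕ W) ≡ 𝒩
  GW∈𝒩 = o⁻-𝒫-option⇒𝒩 {G ⊕ W} (⊕-optionˡ G W i) G'W∈𝒫
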